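{- Let $P$ be a finite poset, let $P'$ be a barycentric subdivision of $Diag(P)$, and let $a,b,c,d\in P'$. If $a<c$, $b<d$, $(b,c)\in Diag(P')$ and $(a,b),(d,c)\in Inc(P')$, then $b,c\in P$. If, moreover, $(a,c),(b,d)\in Diag(P')$ and $a<d$, then $a,d\in P$.
   Context: For a poset $Q$, a covering pair is $(x,y)$ with $x<y$ and no $z$ with $x<z<y$; write $x\prec y$. $Diag(Q)$ is the directed graph on $Q$ whose edges are the covering pairs, and $Inc(Q)$ is the set of pairs of incomparable elements of $Q$. A barycentric subdivision of $Diag(P)$ is the poset obtained by adding finitely many (possibly zero) new vertices on each edge of $Diag(P)$, i.e. replacing each edge $(x,y)$ by a path $x\prec u_1\prec\cdots\prec u_k\prec y$ of new vertices and taking the reflexive-transitive closure; it contains $P$ as an induced subposet. All order relations in the statement are those of $P'$. -}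

module Defs where

open import Data.Nat using (ℕ; zero; suc)
open import Data.Fin using (Fin; toℕ)
open import Data.Product using (Σ; _×_; _,_)
open import Data.Sum using (_⊎_; inj₁; inj₂)
open import Relation.Nullary using (¬_)
open import Relation.Binary.PropositionalEquality using (_≡_)
open import Relation.Binary.Construct.Closure.ReflexiveTransitive using (Star)

module _ {A : Set} (R : A → A → Set) where
  Strict : A → A → Set
  Strict x y = R x y × ¬ (x ≡ y)

  Cover : A → A → Set
  Cover x y = Strict x y × (∀ z → ¬ (Strict x z × Strict z y))

  Incomp : A → A → Set
  Incomp x y = ¬ R x y × ¬ R y x

-- Vertices of a barycentric subdivision of Diag(P), P on Fin n:
-- the original vertices (inj₁ x) and, for each pair (x , y), k x y new
-- vertices (inj₂ (x , y , i)), i = 0 .. k x y - 1, placed on the edge x ≺ y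
-- in the order x ≺ u₀ ≺ u₁ ≺ … ≺ u_{k-1} ≺ y.
-- (k x y is required to be 0 when (x , y) is not a covering pair.)
SubVertex : (n : ℕ) → (Fin n → Fin n → ℕ) → Set
SubVertex n k = Fin n ⊎ Σ (Fin n) (λ x → Σ (Fin n) (λ y → Fin (k x y)))

data SubEdge {n : ℕ} (_≤_ : Fin n → Fin n → Set) (k : Fin n → Fin n → ℕ)
     : SubVertex n k → SubVertex n k → Set where
  direct : ∀ {x y} → Cover _≤_ x y → k x y ≡ 0 → SubEdge _≤_ k (inj₁ x) (inj₁ y)
  first  : ∀ {x y} (i : Fin (k x y)) → toℕ i ≡ 0 →
           SubEdge _≤_ k (inj₁ x) (inj₂ (x , y , i))
  step   : ∀ {x y} (i j : Fin (k x y)) → toℕ j ≡ suc (toℕ i) →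
           SubEdge _≤_ k (inj₂ (x , y , i)) (inj₂ (x , y , j))
  last   : ∀ {x y} (i : Fin (k x y)) → suc (toℕ i) ≡ k x y →
           SubEdge _≤_ k (inj₂ (x , y , i)) (inj₁ y)

SubLe : {n : ℕ} (_≤_ : Fin n → Fin n → Set) (k : Fin n → Fin n → ℕ) →
        SubVertex n k → SubVertex n k → Set
SubLe _≤_ k = Star (SubEdge _≤_ k)

InP : {n : ℕ} {k : Fin n → Fin n → ℕ} → SubVertex n k → Set
InP {n} v = Σ (Fin n) (λ x → v ≡ inj₁ x)

-- A vertex subdivided into an edge has exactly one successor and exactly one
-- predecessor in Diag(P'). If u has a unique successor and u ≺ w, then w is the
-- least element strictly above u; dually for a unique predecessor. Hence a new
-- vertex b with b ≺ c and b < d would force c ≤ d, and a new vertex c with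
-- b ≺ c and a < c would force a ≤ b, contradicting incomparability; the second
-- part is the same argument for a ≺ c, a < d and b ≺ d, a < d.
module Submission where

open import Defs
open import Data.Nat using (ℕ)
open import Data.Fin using (Fin)
open import Data.Product using (_×_; _,_; proj₁; proj₂)
open import Data.Sum using (inj₁; inj₂)
open import Data.Empty using (⊥-elim)
open import Function using (flip; id; _∘_)
open import Relation.Nullary using (¬_)
open import Relation.Binary.PropositionalEquality using (_≡_; _≢_; refl; sym; trans; cong; subst)
open import Relation.Binary.Structures using (IsDecPartialOrder)
open import Relation.Binary.Construct.Closure.ReflexiveTransitive using (Star; ε; _◅_; reverse)
import Data.Nat.Properties as ℕ
import Data.Fin.Properties as Fin

module _ {A : Set} (R : A → A → Set) where

  UniqueSucc : A → Set
  UniqueSucc u = ∀ {e e′} → R u e → R u e′ → e ≡ e′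

  UniquePred : A → Set
  UniquePred w = ∀ {e e′} → R e w → R e′ w → e ≡ e′

strict-flip : ∀ {A : Set} {R : A → A → Set} {x y} →
              Strict (Star R) x y → Strict (Star (flip R)) y x
strict-flip (xy , x≢y) = reverse id xy , x≢y ∘ sym

module _ {A : Set} {R : A → A → Set} where

  cover-flip : ∀ {x y} → Cover (Star R) x y → Cover (Star (flip R)) y x
  cover-flip (x<y , minimal) = strict-flip x<y , λ z (y<z , z<x) →
    minimal z (strict-flip {R = flip R} z<x , strict-flip y<z)

  -- Constructively only ¬¬: we cannot decide whether the first step out of u
  -- already reaches w.
  uniqueSucc⇒cover-least : (∀ {x y} → R x y → x ≢ y) → ∀ {u w v} → UniqueSucc R u →
                           Cover (Star R) u w → Strict (Star R) u v → ¬ ¬ Star R w v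
  uniqueSucc⇒cover-least _ _ ((ε , u≢w) , _) _ = ⊥-elim (u≢w refl)
  uniqueSucc⇒cover-least _ _ _ (ε , u≢v) = ⊥-elim (u≢v refl)
  uniqueSucc⇒cover-least irrefl unique ((r ◅ ew , _) , minimal) (r′ ◅ e′v , _) w≰v
    with unique r r′
  ... | refl = minimal _ ((r ◅ ε , irrefl r) , (ew , e≢w))
    where
    e≢w : _ ≢ _
    e≢w e≡w = w≰v (subst (λ x → Star R x _) e≡w e′v)

uniquePred⇒cover-greatest : ∀ {A : Set} {R : A → A → Set} → (∀ {x y} → R x y → x ≢ y) →
                            ∀ {u w v} → UniquePred R w →
                            Cover (Star R) u w → Strict (Star R) v w → ¬ ¬ Star R v u
uniquePred⇒cover-greatest {R = R} irrefl unique u⋖w v<w v≰u =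
  uniqueSucc⇒cover-least {R = flip R} (λ r → irrefl r ∘ sym) unique
    (cover-flip u⋖w) (strict-flip v<w) (v≰u ∘ reverse id)

module _ {n : ℕ} (_≤_ : Fin n → Fin n → Set) (k : Fin n → Fin n → ℕ) where

  private
    E = SubEdge _≤_ k
    L = SubLe _≤_ k

  subEdge-irrefl : ∀ {u v} → E u v → u ≢ v
  subEdge-irrefl (direct x⋖y _) refl = proj₂ (proj₁ x⋖y) refl
  subEdge-irrefl (step i .i j≡1+i) refl = ℕ.1+n≢n (sym j≡1+i)

  new-uniqueSucc : ∀ {x y} (i : Fin (k x y)) → UniqueSucc E (inj₂ (x , y , i))
  new-uniqueSucc i (step .i j p) (step .i j′ p′) =
    cong (λ m → inj₂ (_ , _ , m)) (Fin.toℕ-injective (trans p (sym p′)))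
  new-uniqueSucc i (step .i j p) (last .i q) = ⊥-elim (ℕ.<-irrefl (trans p q) (Fin.toℕ<n j))
  new-uniqueSucc i (last .i q) (step .i j p) = ⊥-elim (ℕ.<-irrefl (trans p q) (Fin.toℕ<n j))
  new-uniqueSucc i (last .i _) (last .i _) = refl

  new-uniquePred : ∀ {x y} (j : Fin (k x y)) → UniquePred E (inj₂ (x , y , j))
  new-uniquePred j (first .j _) (first .j _) = refl
  new-uniquePred j (first .j j≡0) (step i .j q) = ⊥-elim (ℕ.1+n≢0 (trans (sym q) j≡0))
  new-uniquePred j (step i .j q) (first .j j≡0) = ⊥-elim (ℕ.1+n≢0 (trans (sym q) j≡0))
  new-uniquePred j (step i .j q) (step i′ .j q′) =
    cong (λ m → inj₂ (_ , _ , m)) (Fin.toℕ-injective (ℕ.suc-injective (trans (sym q) q′)))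

  InP-of-cover-strictUpper : ∀ {u w v} → Cover L u w → Strict L u v → ¬ L w v → InP {n} {k} u
  InP-of-cover-strictUpper {inj₁ x} _ _ _ = x , refl
  InP-of-cover-strictUpper {inj₂ (_ , _ , i)} u⋖w u<v w≰v =
    ⊥-elim (uniqueSucc⇒cover-least subEdge-irrefl (new-uniqueSucc i) u⋖w u<v w≰v)

  InP-of-cover-strictLower : ∀ {u w v} → Cover L u w → Strict L v w → ¬ L v u → InP {n} {k} w
  InP-of-cover-strictLower {w = inj₁ y} _ _ _ = y , refl
  InP-of-cover-strictLower {w = inj₂ (_ , _ , j)} u⋖w v<w v≰u =
    ⊥-elim (uniquePred⇒cover-greatest subEdge-irrefl (new-uniquePred j) u⋖w v<w v≰u)

lemma1 : {n : ℕ} (_≤_ : Fin n → Fin n → Set) → IsDecPartialOrder _≡_ _≤_ →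
         (k : Fin n → Fin n → ℕ) → (∀ x y → ¬ Cover _≤_ x y → k x y ≡ 0) →
         (a b c d : SubVertex n k) →
         Strict (SubLe _≤_ k) a c → Strict (SubLe _≤_ k) b d →
         Cover (SubLe _≤_ k) b c →
         Incomp (SubLe _≤_ k) a b → Incomp (SubLe _≤_ k) d c →
         (InP {n} {k} b × InP {n} {k} c) ×
         (Cover (SubLe _≤_ k) a c → Cover (SubLe _≤_ k) b d →
          Strict (SubLe _≤_ k) a d → InP {n} {k} a × InP {n} {k} d)
lemma1 _≤_ _ k _ a b c d a<c b<d b⋖c (a≰b , _) (_ , c≰d) =
  ( InP-of-cover-strictUpper _≤_ k b⋖c b<d c≰d
  , InP-of-cover-strictLower _≤_ k b⋖c a<c a≰b )
  , λ a⋖c b⋖d a<d →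
      InP-of-cover-strictUpper _≤_ k a⋖c a<d c≰d
    , InP-of-cover-strictLower _≤_ k b⋖d a<d a≰b
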